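{- Let $p \ge 5$ and $p \le q \le 4 + \binom{p-2}{\lfloor \frac{p-2}{2} \rfloor}$. Then $f(K(3,p,q)) = 2$.
   Context: $K(3,p,q)$ is the complete tripartite graph with parts of sizes $3$, $p$, $q$. A strong orientation of a graph is an orientation of all edges making the digraph strongly connected; the diameter of a strongly connected digraph is the maximum directed distance between ordered pairs of vertices. The oriented diameter $f(G)$ is the minimum diameter over all strong orientations of $G$. -}

module Defs where

open import Level using (Level; _⊔_; suc)
open import Data.Nat using (ℕ; zero; suc; _<_)
open import Data.Fin using (Fin)
open import Data.Sum using (_⊎_; inj₁; inj₂)
open import Data.Product using (Σ; ∃; _×_; _,_)
open import Relation.Nullary using (¬_)
open import Relation.Binary.PropositionalEquality using (_≡_)

record Graph : Set₁ where
  field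
    V     : Set
    Adj   : V → V → Set
    irrefl : ∀ {u} → ¬ Adj u u
    sym   : ∀ {u v} → Adj u v → Adj v u

module _ (G : Graph) where
  open Graph G

  record IsOrientation (Arc : V → V → Set) : Set where
    field
      arc⇒adj : ∀ {u v} → Arc u v → Adj u v
      adj⇒arc : ∀ {u v} → Adj u v → Arc u v ⊎ Arc v u
      antisym : ∀ {u v} → Arc u v → ¬ Arc v u

module _ {V : Set} (Arc : V → V → Set) where
  Within : ℕ → V → V → Set
  Within zero    u v = u ≡ v
  Within (suc k) u v = Within k u v ⊎ Σ V (λ w → Arc u w × Within k w v)

  StronglyConnected : Set
  StronglyConnected = ∀ u v → ∃ λ k → Within k u v

  DiamLe : ℕ → Set
  DiamLe d = ∀ u v → Within d u v

OrientedDiameterIs : Graph → ℕ → Set₁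
OrientedDiameterIs G d =
  (Σ (Graph.V G → Graph.V G → Set) λ Arc →
      IsOrientation G Arc × StronglyConnected Arc × DiamLe Arc d)
  × (∀ (Arc : Graph.V G → Graph.V G → Set) → IsOrientation G Arc →
      StronglyConnected Arc → ∀ d' → d' < d → ¬ DiamLe Arc d')

data Part : Set where
  P₁ P₂ P₃ : Part

module _ {a b c : ℕ} where
  part : Fin a ⊎ (Fin b ⊎ Fin c) → Part
  part (inj₁ _)        = P₁
  part (inj₂ (inj₁ _)) = P₂
  part (inj₂ (inj₂ _)) = P₃

Ktri : ℕ → ℕ → ℕ → Graph
Ktri a b c = record
  { V = Fin a ⊎ (Fin b ⊎ Fin c)
  ; Adj = λ u v → ¬ (part {a} {b} {c} u ≡ part {a} {b} {c} v)
  ; irrefl = λ h → h Relation.Binary.PropositionalEquality.refl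
  ; sym = λ h e → h (Relation.Binary.PropositionalEquality.sym e)
  }

{-# OPTIONS --safe #-}
-- Let m = p − 2 and split B into two special vertices s₀, s₁ and m ordinary ones. The ⌊m/2⌋-subsets
-- of the ordinary vertices form an antichain (Sperner) of nonempty proper sets, of size m C ⌊m/2⌋.
-- The first p vertices of C are copies c(b) of the vertices b of B, each further one is a block carrying
-- its own member S of the antichain. In A = {a₀, a₁, a₂}, an ordinary vertex is entered only from a₀,
-- a special one only from a₂, and c(b) is entered exactly from the vertices of A not entering b;
-- b → c(b) → b′ for all b′ ≠ b. A block S is entered from a₁ and from the vertices of B outside S,
-- and leaves towards everything else. Every ordered pair is then joined by a path of length at most 2,
-- where two blocks need an element of one set missing from the other, i.e. the antichain property.
-- Conversely, two vertices of B are non-adjacent, so no orientation has diameter below 2.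
module Submission where

open import Defs
open import Data.Nat using (ℕ; zero; suc; _≤_; _<_; _+_; _∸_; _/_; s≤s; z≤n)
open import Data.Nat.Combinatorics using (_C_; nCk+nC[k+1]≡[n+1]C[k+1])
open import Data.Empty using (⊥)
open import Data.Nat.Properties using (<⇒≢; m<n⇒0<n∸m; ≤-trans; +-monoˡ-≤; m≤m+n)
open import Data.Nat.DivMod using (m/n<m; m≥n⇒m/n>0)
open import Data.Fin using (Fin; zero; suc; splitAt; cast; toℕ; inject≤; _↑ˡ_)
open import Data.Fin.Properties
  using (_≟_; +↔⊎; any?; toℕ-cast; toℕ-injective; splitAt-↑ˡ; toℕ-inject≤; toℕ-↑ˡ; inject≤-injective)
open import Data.Fin.Subset using (Subset; inside; outside; _∈_; _∉_; _⊆_; Nonempty; ∣_∣) renaming (⊥ to ∅)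
open import Data.Fin.Subset.Properties
  using (_∈?_; nonempty?; drop-there; Empty-unique; ∣⊥∣≡0; ∣∁p∣≡n∸∣p∣; x∈∁p⇒x∉p; ⊆-antisym; p⊂q⇒∣p∣<∣q∣)
open import Data.Vec using (_∷_; []; tail; there)
open import Data.Product using (∃; _×_; _,_)
open import Data.Sum using (_⊎_; inj₁; inj₂; map₂; swap)
open import Data.Sum.Properties using (inj₂-injective)
open import Function using (_∘_; Injective; Injection)
open import Function.Properties.Inverse using (↔⇒↣)
open import Relation.Nullary using (¬_; Dec; yes; no; contradiction; ¬?; _×-dec_)
open import Relation.Nullary.Decidable using (toSum; decidable-stable)
open import Relation.Binary using (Decidable)
open import Relation.Binary.PropositionalEquality

pattern vA x = inj₁ x
pattern vB y = inj₂ (inj₁ y)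
pattern vC z = inj₂ (inj₂ z)

module _ {X Y Z : Set} (R : X → Y → Set) (S : X → Z → Set) (T : Y → Z → Set) where

  tripartiteArc : X ⊎ (Y ⊎ Z) → X ⊎ (Y ⊎ Z) → Set
  tripartiteArc (vA x) (vB y) = R x y
  tripartiteArc (vB y) (vA x) = ¬ R x y
  tripartiteArc (vA x) (vC z) = S x z
  tripartiteArc (vC z) (vA x) = ¬ S x z
  tripartiteArc (vB y) (vC z) = T y z
  tripartiteArc (vC z) (vB y) = ¬ T y z
  tripartiteArc _      _      = ⊥

module _ {X Y Z Z′ : Set} {R : X → Y → Set} {S : X → Z → Set} {T : Y → Z → Set} (f : Z′ → Z) where

  tripartiteArc-comap : ∀ u v → tripartiteArc R S T (map₂ (map₂ f) u) (map₂ (map₂ f) v) →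
                        tripartiteArc R (λ x z → S x (f z)) (λ y z → T y (f z)) u v
  tripartiteArc-comap (vA _) (vB _) arc = arc
  tripartiteArc-comap (vB _) (vA _) arc = arc
  tripartiteArc-comap (vA _) (vC _) arc = arc
  tripartiteArc-comap (vC _) (vA _) arc = arc
  tripartiteArc-comap (vB _) (vC _) arc = arc
  tripartiteArc-comap (vC _) (vB _) arc = arc
  tripartiteArc-comap (vA _) (vA _) ()
  tripartiteArc-comap (vB _) (vB _) ()
  tripartiteArc-comap (vC _) (vC _) ()

module _ {a b c : ℕ} {R : Fin a → Fin b → Set} {S : Fin a → Fin c → Set} {T : Fin b → Fin c → Set}
         (R? : Decidable R) (S? : Decidable S) (T? : Decidable T) where

  private
    G = Ktri a b c
    Arc = tripartiteArc R S T

  tripartiteArc-isOrientation : IsOrientation G Arc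
  tripartiteArc-isOrientation = record
    { arc⇒adj = arc⇒adj ; adj⇒arc = adj⇒arc ; antisym = λ {u} {v} → antisym {u} {v} }
    where
    arc⇒adj : ∀ {u v} → Arc u v → Graph.Adj G u v
    arc⇒adj {vA _} {vB _} _ ()
    arc⇒adj {vB _} {vA _} _ ()
    arc⇒adj {vA _} {vC _} _ ()
    arc⇒adj {vC _} {vA _} _ ()
    arc⇒adj {vB _} {vC _} _ ()
    arc⇒adj {vC _} {vB _} _ ()

    adj⇒arc : ∀ {u v} → Graph.Adj G u v → Arc u v ⊎ Arc v u
    adj⇒arc {vA x} {vB y} _ = toSum (R? x y)
    adj⇒arc {vB y} {vA x} _ = swap (toSum (R? x y))
    adj⇒arc {vA x} {vC z} _ = toSum (S? x z)
    adj⇒arc {vC z} {vA x} _ = swap (toSum (S? x z))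
    adj⇒arc {vB y} {vC z} _ = toSum (T? y z)
    adj⇒arc {vC z} {vB y} _ = swap (toSum (T? y z))
    adj⇒arc {vA _} {vA _} ¬same = contradiction refl ¬same
    adj⇒arc {vB _} {vB _} ¬same = contradiction refl ¬same
    adj⇒arc {vC _} {vC _} ¬same = contradiction refl ¬same

    antisym : ∀ {u v} → Arc u v → ¬ Arc v u
    antisym {vA _} {vB _} r ¬r = ¬r r
    antisym {vB _} {vA _} ¬r r = ¬r r
    antisym {vA _} {vC _} r ¬r = ¬r r
    antisym {vC _} {vA _} ¬r r = ¬r r
    antisym {vB _} {vC _} r ¬r = ¬r r
    antisym {vC _} {vB _} ¬r r = ¬r r

diameter≥2 : ∀ {G : Graph} {Arc} → IsOrientation G Arc → ∀ {u v} → u ≢ v → ¬ Graph.Adj G u v →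
             ∀ {d} → d < 2 → ¬ DiamLe Arc d
diameter≥2 _ u≢v _ {zero} _ diam = u≢v (diam _ _)
diameter≥2 o {u} {v} u≢v ¬adj {suc zero} _ diam with diam u v
... | inj₁ u≡v = u≢v u≡v
... | inj₂ (_ , arc , refl) = ¬adj (IsOrientation.arc⇒adj o arc)
diameter≥2 _ _ _ {suc (suc _)} (s≤s (s≤s ()))

splitAt-injective : ∀ m {n} → Injective _≡_ _≡_ (splitAt m {n})
splitAt-injective m = Injection.injective (↔⇒↣ +↔⊎)

cast-injective : ∀ {m n} .(eq : m ≡ n) {i j : Fin m} → cast eq i ≡ cast eq j → i ≡ j
cast-injective eq {i} {j} e = toℕ-injective (begin
  toℕ i          ≡⟨ toℕ-cast eq i ⟨
  toℕ (cast eq i) ≡⟨ cong toℕ e ⟩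
  toℕ (cast eq j) ≡⟨ toℕ-cast eq j ⟩
  toℕ j          ∎)
  where open ≡-Reasoning

module _ {n : ℕ} where

  0<∣p∣⇒Nonempty : {p : Subset n} → 0 < ∣ p ∣ → Nonempty p
  0<∣p∣⇒Nonempty {p} 0<∣p∣ with nonempty? p
  ... | yes ne = ne
  ... | no ¬ne = contradiction (trans (cong ∣_∣ (Empty-unique ¬ne)) (∣⊥∣≡0 n)) (<⇒≢ 0<∣p∣ ∘ sym)

  ∣p∣<n⇒∃∉ : {p : Subset n} → ∣ p ∣ < n → ∃ λ x → x ∉ p
  ∣p∣<n⇒∃∉ {p} ∣p∣<n with 0<∣p∣⇒Nonempty (subst (0 <_) (sym (∣∁p∣≡n∸∣p∣ p)) (m<n⇒0<n∸m ∣p∣<n))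
  ... | x , x∈∁p = x , x∈∁p⇒x∉p x∈∁p

  difference? : ∀ (p q : Subset n) → Dec (∃ λ x → x ∈ p × x ∉ q)
  difference? p q = any? (λ x → (x ∈? p) ×-dec ¬? (x ∈? q))

  ¬∃∈p∉q⇒p⊆q : {p q : Subset n} → ¬ (∃ λ x → x ∈ p × x ∉ q) → p ⊆ q
  ¬∃∈p∉q⇒p⊆q {q = q} ∄ {x} x∈p = decidable-stable (x ∈? q) (λ x∉q → ∄ (x , x∈p , x∉q))

  ∣p∣≡∣q∣⇒p≢q⇒∃∈p∉q : {p q : Subset n} → ∣ p ∣ ≡ ∣ q ∣ → p ≢ q → ∃ λ x → x ∈ p × x ∉ q
  ∣p∣≡∣q∣⇒p≢q⇒∃∈p∉q {p} {q} ∣p∣≡∣q∣ p≢q with difference? p q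
  ... | yes p∖q = p∖q
  ... | no ∄p∖q with difference? q p
  ...   | yes (x , x∈q , x∉p) =
    contradiction ∣p∣≡∣q∣ (<⇒≢ (p⊂q⇒∣p∣<∣q∣ (¬∃∈p∉q⇒p⊆q ∄p∖q , x , x∈q , x∉p)))
  ...   | no ∄q∖p = contradiction (⊆-antisym (¬∃∈p∉q⇒p⊆q ∄p∖q) (¬∃∈p∉q⇒p⊆q ∄q∖p)) p≢q

-- Pascal's rule ranks the (k+1)-subsets of Fin (suc n): first those containing zero, then the others.
mutual
  kSubset : ∀ n k → Fin (n C k) → Subset n
  kSubset zero    _       _ = []
  kSubset (suc n) zero    _ = ∅
  kSubset (suc n) (suc k) t =
    kSubset-split n k (splitAt (n C k) (cast (sym (nCk+nC[k+1]≡[n+1]C[k+1] n k)) t))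

  kSubset-split : ∀ n k → Fin (n C k) ⊎ Fin (n C suc k) → Subset (suc n)
  kSubset-split n k (inj₁ t) = inside  ∷ kSubset n k t
  kSubset-split n k (inj₂ t) = outside ∷ kSubset n (suc k) t

mutual
  ∣kSubset∣ : ∀ n k (t : Fin (n C k)) → ∣ kSubset n k t ∣ ≡ k
  ∣kSubset∣ zero    zero    _ = refl
  ∣kSubset∣ (suc n) zero    _ = ∣⊥∣≡0 (suc n)
  ∣kSubset∣ (suc n) (suc k) t = ∣kSubset-split∣ n k (splitAt (n C k) (cast _ t))

  ∣kSubset-split∣ : ∀ n k (t : Fin (n C k) ⊎ Fin (n C suc k)) → ∣ kSubset-split n k t ∣ ≡ suc k
  ∣kSubset-split∣ n k (inj₁ t) = cong suc (∣kSubset∣ n k t)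
  ∣kSubset-split∣ n k (inj₂ t) = ∣kSubset∣ n (suc k) t

mutual
  kSubset-injective : ∀ n k {t u : Fin (n C k)} → kSubset n k t ≡ kSubset n k u → t ≡ u
  kSubset-injective zero    zero    {zero} {zero} _ = refl
  kSubset-injective (suc n) zero    {zero} {zero} _ = refl
  kSubset-injective (suc n) (suc k) eq =
    cast-injective _ (splitAt-injective (n C k) (kSubset-split-injective n k eq))

  kSubset-split-injective : ∀ n k {t u} → kSubset-split n k t ≡ kSubset-split n k u → t ≡ u
  kSubset-split-injective n k {inj₁ t} {inj₁ u} eq = cong inj₁ (kSubset-injective n k (cong tail eq))
  kSubset-split-injective n k {inj₂ t} {inj₂ u} eq = cong inj₂ (kSubset-injective n (suc k) (cong tail eq))
  kSubset-split-injective n k {inj₁ t} {inj₂ u} ()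
  kSubset-split-injective n k {inj₂ t} {inj₁ u} ()

module _ {n k : ℕ} where

  kSubset-nonempty : 0 < k → ∀ t → Nonempty (kSubset n k t)
  kSubset-nonempty 0<k t = 0<∣p∣⇒Nonempty (subst (0 <_) (sym (∣kSubset∣ n k t)) 0<k)

  kSubset-proper : k < n → ∀ t → ∃ λ x → x ∉ kSubset n k t
  kSubset-proper k<n t = ∣p∣<n⇒∃∉ (subst (_< n) (sym (∣kSubset∣ n k t)) k<n)

  kSubset-antichain : ∀ {t u} → t ≢ u → ∃ λ x → x ∈ kSubset n k t × x ∉ kSubset n k u
  kSubset-antichain {t} {u} t≢u =
    ∣p∣≡∣q∣⇒p≢q⇒∃∈p∉q (trans (∣kSubset∣ n k t) (sym (∣kSubset∣ n k u))) (t≢u ∘ kSubset-injective n k)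

pattern a₀ = zero
pattern a₁ = suc zero
pattern a₂ = suc (suc zero)

pattern s₀ = zero
pattern s₁ = suc zero
pattern ordinary o = suc (suc o)

pattern copy b = inj₁ b
pattern block t = inj₂ t

module AntichainOrientation
  {n N : ℕ} (family : Fin N → Subset (2 + n))
  (family-nonempty : ∀ t → Nonempty (family t))
  (family-proper : ∀ t → ∃ λ x → x ∉ family t)
  (family-antichain : ∀ {t u} → t ≢ u → ∃ λ x → x ∈ family t × x ∉ family u)
  where

  Kind : Set
  Kind = Fin (4 + n) ⊎ Fin N

  data ArcAB : Fin 3 → Fin (4 + n) → Set where
    a₀⇒ordinary : ∀ {o} → ArcAB a₀ (ordinary o)
    a₂⇒s₀ : ArcAB a₂ s₀
    a₂⇒s₁ : ArcAB a₂ s₁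

  blockTargets : Fin N → Subset (4 + n)
  blockTargets t = outside ∷ outside ∷ family t

  ArcAC : Fin 3 → Kind → Set
  ArcAC a (copy b)  = ¬ ArcAB a b
  ArcAC a (block t) = a ≡ a₁

  ArcBC : Fin (4 + n) → Kind → Set
  ArcBC b (copy b′) = b ≡ b′
  ArcBC b (block t) = b ∉ blockTargets t

  arcAB? : ∀ a b → Dec (ArcAB a b)
  arcAB? a₀ (ordinary o) = yes a₀⇒ordinary
  arcAB? a₀ s₀ = no λ ()
  arcAB? a₀ s₁ = no λ ()
  arcAB? a₁ _  = no λ ()
  arcAB? a₂ s₀ = yes a₂⇒s₀
  arcAB? a₂ s₁ = yes a₂⇒s₁
  arcAB? a₂ (ordinary o) = no λ ()

  arcAC? : ∀ a k → Dec (ArcAC a k)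
  arcAC? a (copy b)  = ¬? (arcAB? a b)
  arcAC? a (block t) = a ≟ a₁

  arcBC? : ∀ b k → Dec (ArcBC b k)
  arcBC? b (copy b′) = b ≟ b′
  arcBC? b (block t) = ¬? (b ∈? blockTargets t)

  inNeighbour : ∀ b → ∃ λ a → ArcAB a b × a ≢ a₁
  inNeighbour s₀ = a₂ , a₂⇒s₀ , λ ()
  inNeighbour s₁ = a₂ , a₂⇒s₁ , λ ()
  inNeighbour (ordinary o) = a₀ , a₀⇒ordinary , λ ()

  outNeighbour : ∀ b → ∃ λ a → ¬ ArcAB a b × a ≢ a₁
  outNeighbour s₀ = a₀ , (λ ()) , λ ()
  outNeighbour s₁ = a₀ , (λ ()) , λ ()
  outNeighbour (ordinary o) = a₂ , (λ ()) , λ ()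

  anotherOutNeighbour : ∀ a b → ∃ λ b′ → b ≢ b′ × ¬ ArcAB a b′
  anotherOutNeighbour a₀ s₀ = s₁ , (λ ()) , λ ()
  anotherOutNeighbour a₀ (suc _) = s₀ , (λ ()) , λ ()
  anotherOutNeighbour a₁ zero = suc zero , (λ ()) , λ ()
  anotherOutNeighbour a₁ (suc _) = zero , (λ ()) , λ ()
  anotherOutNeighbour a₂ (ordinary zero) = ordinary (suc zero) , (λ ()) , λ ()
  anotherOutNeighbour a₂ (ordinary (suc _)) = ordinary zero , (λ ()) , λ ()
  anotherOutNeighbour a₂ s₀ = ordinary zero , (λ ()) , λ ()
  anotherOutNeighbour a₂ s₁ = ordinary zero , (λ ()) , λ ()

  Vertex : Set
  Vertex = Fin 3 ⊎ (Fin (4 + n) ⊎ Kind)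

  Arc : Vertex → Vertex → Set
  Arc = tripartiteArc ArcAB ArcAC ArcBC

  Hub : Set
  Hub = Fin 3 ⊎ (Fin (4 + n) ⊎ Fin (4 + n))

  hub : Hub → Vertex
  hub = map₂ (map₂ copy)

  data Reach₂ (x y : Vertex) : Set where
    stay   : x ≡ y → Reach₂ x y
    direct : Arc x y → Reach₂ x y
    via    : ∀ h → Arc x (hub h) → Arc (hub h) y → Reach₂ x y

  reachFromA : ∀ a y → Reach₂ (vA a) y
  reachFromA a₀ (vA a₀) = stay refl
  reachFromA a₀ (vA a₁) = via (vB (ordinary zero)) a₀⇒ordinary λ ()
  reachFromA a₀ (vA a₂) = via (vB (ordinary zero)) a₀⇒ordinary λ ()
  reachFromA a₁ (vA a₀) = via (vC (ordinary zero)) (λ ()) (λ ¬r → ¬r a₀⇒ordinary)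
  reachFromA a₁ (vA a₁) = stay refl
  reachFromA a₁ (vA a₂) = via (vC s₀) (λ ()) (λ ¬r → ¬r a₂⇒s₀)
  reachFromA a₂ (vA a₀) = via (vB s₀) a₂⇒s₀ λ ()
  reachFromA a₂ (vA a₁) = via (vB s₀) a₂⇒s₀ λ ()
  reachFromA a₂ (vA a₂) = stay refl
  reachFromA a (vB b) with arcAB? a b
  ... | yes r = direct r
  ... | no _ with anotherOutNeighbour a b
  ...   | b′ , b≢b′ , ¬r′ = via (vC b′) ¬r′ b≢b′
  reachFromA a (vC (copy b)) with arcAB? a b
  ... | yes r = via (vB b) r refl
  ... | no ¬r = direct ¬r
  reachFromA a₀ (vC (block t)) with family-proper t
  ... | o , o∉t = via (vB (ordinary o)) a₀⇒ordinary (o∉t ∘ drop-there ∘ drop-there)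
  reachFromA a₁ (vC (block t)) = direct refl
  reachFromA a₂ (vC (block t)) = via (vB s₀) a₂⇒s₀ λ ()

  reachFromB : ∀ b y → Reach₂ (vB b) y
  reachFromB b (vA a) with arcAB? a b
  ... | yes r = via (vC b) refl (λ ¬r → ¬r r)
  ... | no ¬r = direct ¬r
  reachFromB b (vB b′) with b ≟ b′
  ... | yes refl = stay refl
  ... | no b≢b′ = via (vC b) refl (b≢b′ ∘ sym)
  reachFromB b (vC k) = via (vA a₁) (λ ()) (a₁⇒C k)
    where
    a₁⇒C : ∀ k → ArcAC a₁ k
    a₁⇒C (copy _)  = λ ()
    a₁⇒C (block _) = refl

  reachFromC : ∀ k y → Reach₂ (vC k) y
  reachFromC (copy b) (vA a) with arcAB? a b
  ... | yes r = direct (λ ¬r → ¬r r)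
  ... | no _ with anotherOutNeighbour a b
  ...   | b′ , b≢b′ , ¬r′ = via (vB b′) (b≢b′ ∘ sym) ¬r′
  reachFromC (block t) (vA a₀) = direct λ ()
  reachFromC (block t) (vA a₁) with family-nonempty t
  ... | o , o∈t = via (vB (ordinary o)) (λ o∉t → o∉t (there (there o∈t))) λ ()
  reachFromC (block t) (vA a₂) = direct λ ()
  reachFromC (copy b) (vB b′) with b′ ≟ b
  ... | no b′≢b = direct b′≢b
  ... | yes refl with inNeighbour b
  ...   | a , r , _ = via (vA a) (λ ¬r → ¬r r) r
  reachFromC (block t) (vB b) with inNeighbour b
  ... | a , r , a≢a₁ = via (vA a) a≢a₁ r
  reachFromC (copy b) (vC (copy b′)) with b ≟ b′
  ... | yes refl = stay refl
  ... | no b≢b′ = via (vB b′) (b≢b′ ∘ sym) refl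
  reachFromC (copy s₀) (vC (block t)) = via (vB s₁) (λ ()) λ { (there ()) }
  reachFromC (copy (suc _)) (vC (block t)) = via (vB s₀) (λ ()) λ ()
  reachFromC (block t) (vC (copy b)) with outNeighbour b
  ... | a , ¬r , a≢a₁ = via (vA a) a≢a₁ ¬r
  reachFromC (block t) (vC (block u)) with t ≟ u
  ... | yes refl = stay refl
  ... | no t≢u with family-antichain t≢u
  ...   | o , o∈t , o∉u =
    via (vB (ordinary o)) (λ o∉t → o∉t (there (there o∈t))) (o∉u ∘ drop-there ∘ drop-there)

  reach : ∀ x y → Reach₂ x y
  reach (vA a) = reachFromA a
  reach (vB b) = reachFromB b
  reach (vC k) = reachFromC k

  module _ {q : ℕ} (p≤q : 4 + n ≤ q) (q≤p+N : q ≤ 4 + n + N) where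

    kind : Fin q → Kind
    kind c = splitAt (4 + n) (inject≤ c q≤p+N)

    copyVertex : Fin (4 + n) → Fin q
    copyVertex b = inject≤ b p≤q

    kind-copyVertex : ∀ b → kind (copyVertex b) ≡ copy b
    kind-copyVertex b = begin
      splitAt (4 + n) (inject≤ (inject≤ b p≤q) q≤p+N)
        ≡⟨ cong (splitAt (4 + n)) (toℕ-injective toℕ-equal) ⟩
      splitAt (4 + n) (b ↑ˡ N)
        ≡⟨ splitAt-↑ˡ (4 + n) b N ⟩
      copy b
        ∎
      where
      open ≡-Reasoning
      toℕ-equal : toℕ (inject≤ (inject≤ b p≤q) q≤p+N) ≡ toℕ (b ↑ˡ N)
      toℕ-equal = trans (toℕ-inject≤ _ q≤p+N) (trans (toℕ-inject≤ b p≤q) (sym (toℕ-↑ˡ b N)))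

    kind-injective : ∀ {c c′} → kind c ≡ kind c′ → c ≡ c′
    kind-injective {c} {c′} eq = inject≤-injective q≤p+N q≤p+N c c′ (splitAt-injective (4 + n) eq)

    ktriArc : Fin 3 ⊎ (Fin (4 + n) ⊎ Fin q) → Fin 3 ⊎ (Fin (4 + n) ⊎ Fin q) → Set
    ktriArc = tripartiteArc ArcAB (λ a c → ArcAC a (kind c)) (λ b c → ArcBC b (kind c))

    ktriArc-isOrientation : IsOrientation (Ktri 3 (4 + n) q) ktriArc
    ktriArc-isOrientation =
      tripartiteArc-isOrientation arcAB? (λ a c → arcAC? a (kind c)) (λ b c → arcBC? b (kind c))

    classify : Fin 3 ⊎ (Fin (4 + n) ⊎ Fin q) → Vertex
    classify = map₂ (map₂ kind)

    classify-injective : ∀ {u v} → classify u ≡ classify v → u ≡ v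
    classify-injective {vA _} {vA _} refl = refl
    classify-injective {vB _} {vB _} refl = refl
    classify-injective {vC _} {vC _} eq = cong vC (kind-injective (inj₂-injective (inj₂-injective eq)))

    realHub : Hub → Fin 3 ⊎ (Fin (4 + n) ⊎ Fin q)
    realHub = map₂ (map₂ copyVertex)

    classify-realHub : ∀ h → classify (realHub h) ≡ hub h
    classify-realHub (vA _) = refl
    classify-realHub (vB _) = refl
    classify-realHub (vC b) = cong vC (kind-copyVertex b)

    realise : ∀ u v → Reach₂ (classify u) (classify v) → Within ktriArc 2 u v
    realise u v (stay eq) = inj₁ (inj₁ (classify-injective eq))
    realise u v (direct arc) = inj₁ (inj₂ (v , tripartiteArc-comap kind u v arc , refl))
    realise u v (via h arc₁ arc₂) = inj₂ (realHub h , arcTo , inj₂ (v , arcFrom , refl))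
      where
      arcTo : ktriArc u (realHub h)
      arcTo = tripartiteArc-comap kind u (realHub h)
                (subst (Arc (classify u)) (sym (classify-realHub h)) arc₁)
      arcFrom : ktriArc (realHub h) v
      arcFrom = tripartiteArc-comap kind (realHub h) v
                  (subst (λ x → Arc x (classify v)) (sym (classify-realHub h)) arc₂)

    ktriArc-diameter≤2 : DiamLe ktriArc 2
    ktriArc-diameter≤2 u v = realise u v (reach (classify u) (classify v))

theorem5p6 : ∀ (p q : ℕ) → 5 ≤ p → p ≤ q → q ≤ 4 + ((p ∸ 2) C ((p ∸ 2) / 2)) →
    OrientedDiameterIs (Ktri 3 p q) 2
theorem5p6 (suc (suc (suc (suc (suc r))))) q (s≤s (s≤s (s≤s (s≤s (s≤s z≤n))))) p≤q q≤ =
  (ktriArc p≤q q≤p+N , ktriArc-isOrientation p≤q q≤p+N , (λ u v → 2 , diameter≤2 u v) , diameter≤2) ,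
  λ _ isOrientation _ _ → diameter≥2 isOrientation {vB zero} {vB (suc zero)} (λ ()) (λ ¬same → ¬same refl)
  where
  m k : ℕ
  m = 3 + r
  k = m / 2

  open AntichainOrientation (kSubset m k)
    (kSubset-nonempty {m} {k} (m≥n⇒m/n>0 {m} {2} (s≤s (s≤s z≤n))))
    (kSubset-proper {m} {k} (m/n<m m 2 (s≤s (s≤s z≤n))))
    (kSubset-antichain {m} {k})

  q≤p+N : q ≤ 4 + (1 + r) + m C k
  q≤p+N = ≤-trans q≤ (+-monoˡ-≤ (m C k) (m≤m+n 4 (1 + r)))

  diameter≤2 : DiamLe (ktriArc p≤q q≤p+N) 2
  diameter≤2 = ktriArc-diameter≤2 p≤q q≤p+N
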